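{- Let $f_n$ be the index, in intersection order, of the first terminal chord of a uniformly random connected chord diagram with $n$ chords. Define $g_{n,k}$ ($n\ge1$, $k\ge0$) by $g_{n,k}=\mathbb P(f_n=k)$ for $n\in\{1,2,3\}$, and for $n\ge 4$ by $g_{n,0}=g_{n,1}=0$, $g_{n,2}=\frac1{2n}$, $g_{n,k}=(1-\frac1n)g_{n-1,k-1}+\frac1{2n}g_{n-2,k-1}$ for $k\ge3$. Then the ordinary generating function $G(z,u)=\sum_{n\ge1,k\ge0}g_{n,k}z^nu^k$ equals \[G(z,u)=e^{ -z/2}(1-uz)^{ -\frac{1}{2u}}\int_0^z P(x,u)\,\frac{e^{x/2}}{1-x}\,(1-ux)^{\frac{1}{2u}-1}\,dx,\] where $P(x,u)=(1-x)\left(u+xu^2+\frac{x^2u^2}{4}+\frac{x^2u^3}{4}\right)+\frac{x^3u^2}{2}$.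
   Context: A chord diagram with $n$ chords is a perfect matching of $\{1,\dots,2n\}$; each pair $\{a,b\}$ with $a<b$ is a chord. The root chord is the chord containing $1$. The oriented intersection graph has a vertex per chord and an edge from $\{a,b\}$ to $\{c,d\}$ whenever $a<c<b<d$. The diagram is connected if this graph is connected (as an undirected graph); a chord is terminal if its vertex has no outgoing edge. The intersection order of the chords of a connected diagram $C$ is defined recursively: the root chord is first; removing the root chord leaves connected components $C_1,\dots,C_s$ (each regarded as a connected chord diagram, endpoints relabeled order-preservingly) ordered by their smallest endpoint; then come all chords of $C_1$ in their intersection order, then those of $C_2$, etc. -}

module Defs where

open import Data.Bool using (Bool; true; false; _∧_; _∨_; not; if_then_else_)
open import Data.Nat as ℕ using (ℕ; zero; suc; _<ᵇ_; _≡ᵇ_; _∸_)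
open import Data.Integer using (+_)
open import Data.Rational using (ℚ; 0ℚ; 1ℚ; _+_; _*_; _-_; -_; _/_)
open import Data.List using (List; []; _∷_; map; filter; concatMap; length)
open import Data.Bool.ListAction using (any)
open import Data.Product using (_×_; _,_; proj₁; proj₂)
open import Relation.Nullary.Decidable using (T?)

-- A chord {a,b} with a < b is stored as the pair (a , b).
Chord : Set
Chord = ℕ × ℕ

-- A chord diagram is a list of chords; the diagrams produced by
-- 'diagrams n' list their chords by increasing left endpoint.
Diagram : Set
Diagram = List Chord

chordEq : Chord → Chord → Bool
chordEq (a , b) (c , d) = (a ≡ᵇ c) ∧ (b ≡ᵇ d)

elem : Chord → List Chord → Bool
elem c = any (chordEq c)

-- oriented edge {a,b} → {c,d} iff a < c < b < d
crosses : Chord → Chord → Bool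
crosses (a , b) (c , d) = (a <ᵇ c) ∧ (c <ᵇ b) ∧ (b <ᵇ d)

adjacent : Chord → Chord → Bool
adjacent x y = crosses x y ∨ crosses y x

picks : List ℕ → List (ℕ × List ℕ)
picks [] = []
picks (x ∷ xs) = (x , xs) ∷ map (λ p → proj₁ p , x ∷ proj₂ p) (picks xs)

-- all perfect matchings of a list of (increasing) points; the fuel k
-- is the number of chords (the list must have length 2k)
matchings : ℕ → List ℕ → List Diagram
matchings zero [] = [] ∷ []
matchings zero (_ ∷ _) = []
matchings (suc k) [] = []
matchings (suc k) (x ∷ xs) =
  concatMap (λ p → map ((x , proj₁ p) ∷_) (matchings k (proj₂ p))) (picks xs)

from1 : ℕ → List ℕ
from1 m = go m 1
  where
  go : ℕ → ℕ → List ℕ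
  go zero _ = []
  go (suc r) i = i ∷ go r (suc i)

diagrams : ℕ → List Diagram
diagrams n = matchings n (from1 (2 ℕ.* n))

closure : ℕ → Diagram → List Chord → List Chord
closure zero S R = R
closure (suc f) S R =
  closure f S (filter (λ d → T? (elem d R ∨ any (adjacent d) R)) S)

componentOf : Diagram → Chord → List Chord
componentOf S c = closure (length S) S (c ∷ [])

-- connected components of S; since S is listed by increasing left
-- endpoint, they come out ordered by their smallest endpoint
componentsAux : ℕ → Diagram → List Diagram
componentsAux zero S = []
componentsAux (suc f) [] = []
componentsAux (suc f) (c ∷ S) =
  let K = componentOf (c ∷ S) c in
  K ∷ componentsAux f (filter (λ d → T? (not (elem d K))) (c ∷ S))

components : Diagram → List Diagram
components S = componentsAux (length S) S

isConnected : Diagram → Bool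
isConnected D = length (components D) ≡ᵇ 1

-- intersection order (the root chord is the one with smallest left
-- endpoint, i.e. the head of the list; order-preserving relabelling does
-- not change crossings, so it is omitted)
intersectionOrderAux : ℕ → Diagram → List Chord
intersectionOrderAux zero S = []
intersectionOrderAux (suc f) [] = []
intersectionOrderAux (suc f) (r ∷ rest) =
  r ∷ concatMap (intersectionOrderAux f) (components rest)

intersectionOrder : Diagram → List Chord
intersectionOrder D = intersectionOrderAux (length D) D

isTerminal : Diagram → Chord → Bool
isTerminal D c = not (any (crosses c) D)

-- 1-based position in a list of the first element satisfying p (0 if none)
firstIndex : {A : Set} → (A → Bool) → List A → ℕ
firstIndex p [] = 0
firstIndex p (x ∷ xs) = if p x then 1 else (if (firstIndex p xs ≡ᵇ 0) then 0 else suc (firstIndex p xs))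

firstTerminal : Diagram → ℕ
firstTerminal D = firstIndex (isTerminal D) (intersectionOrder D)

count : {A : Set} → (A → Bool) → List A → ℕ
count p xs = length (filter (λ x → T? (p x)) xs)

connectedDiagrams : ℕ → List Diagram
connectedDiagrams n = filter (λ D → T? (isConnected D)) (diagrams n)

probFirstTerminal : ℕ → ℕ → ℚ
probFirstTerminal n k with length (connectedDiagrams n)
... | zero = 0ℚ
... | suc t = (+ count (λ D → firstTerminal D ≡ᵇ k) (connectedDiagrams n)) / suc t

-- The numbers g_{n,k}   (g 0 k = 0 is a dummy value: n ≥ 1 in the paper)

g : ℕ → ℕ → ℚ
g zero k = 0ℚ
g (suc zero) k = probFirstTerminal 1 k
g (suc (suc zero)) k = probFirstTerminal 2 k
g (suc (suc (suc zero))) k = probFirstTerminal 3 k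
g (suc (suc (suc (suc m)))) zero = 0ℚ
g (suc (suc (suc (suc m)))) (suc zero) = 0ℚ
g (suc (suc (suc (suc m)))) (suc (suc zero)) = + 1 / (2 ℕ.* (4 ℕ.+ m))
g (suc (suc (suc (suc m)))) (suc (suc (suc j))) =
  (1ℚ - + 1 / (4 ℕ.+ m)) * g (suc (suc (suc m))) (suc (suc j))
  + (+ 1 / (2 ℕ.* (4 ℕ.+ m))) * g (suc (suc m)) (suc (suc j))

-- Formal power series in z (or x) and u over ℚ:
--   A n k = coefficient of z^n u^k

Series : Set
Series = ℕ → ℕ → ℚ

infixl 6 _⊕_ _⊖_
infixl 7 _⊛_
infixr 8 _^S_

sumTo : ℕ → (ℕ → ℚ) → ℚ
sumTo zero f = f 0
sumTo (suc n) f = sumTo n f + f (suc n)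

_⊕_ : Series → Series → Series
(A ⊕ B) n k = A n k + B n k

_⊖_ : Series → Series → Series
(A ⊖ B) n k = A n k - B n k

scale : ℚ → Series → Series
scale c A n k = c * A n k

_⊛_ : Series → Series → Series
(A ⊛ B) n k = sumTo n (λ i → sumTo k (λ j → A i j * B (n ∸ i) (k ∸ j)))

mono : ℚ → ℕ → ℕ → Series
mono c a b n k = if (n ≡ᵇ a) ∧ (k ≡ᵇ b) then c else 0ℚ

oneS : Series
oneS = mono 1ℚ 0 0

_^S_ : Series → ℕ → Series
A ^S zero = oneS
A ^S suc m = A ⊛ (A ^S m)

invFact : ℕ → ℚ
invFact zero = 1ℚ
invFact (suc m) = invFact m * (+ 1 / suc m)

-- exp(A) = Σ_m A^m / m!, for A without z^0 terms (then A^m only has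
-- terms of z-degree ≥ m, so the coefficient of z^n is a finite sum)
expS : Series → Series
expS A n k = sumTo n (λ m → invFact m * (A ^S m) n k)

integrate : Series → Series
integrate A zero k = 0ℚ
integrate A (suc n) k = A n k * (+ 1 / suc n)

-- 1/(1-z) = Σ z^n
geomZ : Series
geomZ n k = if k ≡ᵇ 0 then 1ℚ else 0ℚ

-- 1/(1-uz) = Σ u^n z^n
geomUZ : Series
geomUZ n k = if n ≡ᵇ k then 1ℚ else 0ℚ

-- log(1 - uz) = - Σ_{m≥1} (uz)^m / m
log1mUZ : Series
log1mUZ zero k = 0ℚ
log1mUZ (suc m) k = if suc m ≡ᵇ k then - (+ 1 / suc m) else 0ℚ

-- division by u of a series with no u^0 terms
divU : Series → Series
divU A n k = A n (suc k)

-- L = -log(1-uz)/(2u), so that (1-uz)^{-1/(2u)} = exp(L)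
L : Series
L = scale (- (+ 1 / 2)) (divU log1mUZ)

pow1mUZ-neg : Series
pow1mUZ-neg = expS L

-- (1-uz)^{1/(2u) - 1} = (1-uz)^{1/(2u)} · (1-uz)^{-1}
pow1mUZ-pos-minus1 : Series
pow1mUZ-pos-minus1 = expS (scale (- 1ℚ) L) ⊛ geomUZ

expCZ : ℚ → Series
expCZ c = expS (mono c 1 0)

z u : Series
z = mono 1ℚ 1 0
u = mono 1ℚ 0 1

P : Series
P = ((oneS ⊖ z) ⊛ (u ⊕ (z ⊛ (u ^S 2)) ⊕ scale (+ 1 / 4) ((z ^S 2) ⊛ (u ^S 2))
                    ⊕ scale (+ 1 / 4) ((z ^S 2) ⊛ (u ^S 3))))
    ⊕ scale (+ 1 / 2) ((z ^S 3) ⊛ (u ^S 2))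

G : Series
G zero k = 0ℚ
G (suc n) k = g (suc n) k

RHS : Series
RHS = expCZ (- (+ 1 / 2)) ⊛ pow1mUZ-neg
      ⊛ integrate (P ⊛ expCZ (+ 1 / 2) ⊛ geomZ ⊛ pow1mUZ-pos-minus1)

-- Both G and the right-hand side F solve the linear equation
-- (1 − uz) ∂F = (uz/2) F + P/(1 − z) with F(0, u) = 0, where ∂ is the derivative in z.
-- Comparing coefficients of z^n u^k, such a solution is determined by
-- (n + 1) F_{n+1,k+1} = n F_{n,k} + F_{n−1,k}/2 + [z^n u^{k+1}] P/(1 − z).
-- For G this is the defining recurrence of g_{n,k} (n ≥ 4) plus the enumerated
-- cases n ≤ 3. The right-hand side is E · ∫ P/(1 − z) · E⁻¹ (1 − uz)⁻¹ with
-- E = e^{−z/2} (1 − uz)^{−1/(2u)}, whose logarithmic derivative is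
-- −1/2 + 1/(2(1 − uz)); the equation then follows from the product rule.
-- The formal exponentials only enter through ∂ exp A = ∂A · exp A and
-- exp A · exp (−A) = 1.
module Submission where

open import Defs
open import Level using (0ℓ)
open import Data.Bool using (true; false; _∧_; if_then_else_; T)
import Data.Bool.Properties as Bool
open import Data.Nat as ℕ using (ℕ; zero; suc; _∸_; _≤_; _<_; _≡ᵇ_; _≤ᵇ_; z≤n; s≤s)
import Data.Nat.Properties as ℕₚ
import Data.Nat.Coprimality as Coprime
open import Data.Integer as ℤ using (+_)
import Data.Sign as Sign
open import Data.Rational using (ℚ; 0ℚ; 1ℚ; _+_; _*_; _-_; -_; _/_; mkℚ)
open import Data.Rational.Properties
open import Data.Rational.Solver using (module +-*-Solver)
open import Data.Sum using (_⊎_; inj₁; inj₂)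
open import Data.Product using (_×_; _,_; proj₁; proj₂)
open import Data.Empty using (⊥-elim)
open import Algebra.Bundles using (CommutativeMonoid)
import Algebra.Solver.CommutativeMonoid as CommutativeMonoidSolver
import Relation.Binary.Reasoning.Setoid as SetoidReasoning
open import Relation.Binary.PropositionalEquality

open +-*-Solver using (solve; _:+_; _:*_; _:-_; :-_; _:=_; con)

-- Finite sums

sumTo-cong≤ : ∀ n {f h : ℕ → ℚ} → (∀ i → i ≤ n → f i ≡ h i) → sumTo n f ≡ sumTo n h
sumTo-cong≤ zero f≡h = f≡h 0 z≤n
sumTo-cong≤ (suc n) f≡h =
  cong₂ _+_ (sumTo-cong≤ n (λ i i≤n → f≡h i (ℕₚ.m≤n⇒m≤1+n i≤n))) (f≡h (suc n) ℕₚ.≤-refl)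

sumTo-cong : ∀ n {f h : ℕ → ℚ} → (∀ i → f i ≡ h i) → sumTo n f ≡ sumTo n h
sumTo-cong n f≡h = sumTo-cong≤ n (λ i _ → f≡h i)

sumTo-zero : ∀ n {f : ℕ → ℚ} → (∀ i → i ≤ n → f i ≡ 0ℚ) → sumTo n f ≡ 0ℚ
sumTo-zero zero f≡0 = f≡0 0 z≤n
sumTo-zero (suc n) f≡0 =
  trans (cong₂ _+_ (sumTo-zero n (λ i i≤n → f≡0 i (ℕₚ.m≤n⇒m≤1+n i≤n))) (f≡0 (suc n) ℕₚ.≤-refl))
        (+-identityˡ 0ℚ)

sumTo-distrib-+ : ∀ n (f h : ℕ → ℚ) → sumTo n (λ i → f i + h i) ≡ sumTo n f + sumTo n h
sumTo-distrib-+ zero f h = refl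
sumTo-distrib-+ (suc n) f h = begin
  sumTo n (λ i → f i + h i) + (f (suc n) + h (suc n))
    ≡⟨ cong (_+ (f (suc n) + h (suc n))) (sumTo-distrib-+ n f h) ⟩
  (sumTo n f + sumTo n h) + (f (suc n) + h (suc n))
    ≡⟨ solve 4 (λ a b c d → (a :+ b) :+ (c :+ d) := (a :+ c) :+ (b :+ d)) refl (sumTo n f) (sumTo n h) (f (suc n)) (h (suc n)) ⟩
  sumTo (suc n) f + sumTo (suc n) h ∎
  where open ≡-Reasoning

sumTo-distrib-- : ∀ n (f h : ℕ → ℚ) → sumTo n (λ i → f i - h i) ≡ sumTo n f - sumTo n h
sumTo-distrib-- zero f h = refl
sumTo-distrib-- (suc n) f h = begin
  sumTo n (λ i → f i - h i) + (f (suc n) - h (suc n))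
    ≡⟨ cong (_+ (f (suc n) - h (suc n))) (sumTo-distrib-- n f h) ⟩
  (sumTo n f - sumTo n h) + (f (suc n) - h (suc n))
    ≡⟨ solve 4 (λ a b c d → (a :- b) :+ (c :- d) := (a :+ c) :- (b :+ d)) refl (sumTo n f) (sumTo n h) (f (suc n)) (h (suc n)) ⟩
  sumTo (suc n) f - sumTo (suc n) h ∎
  where open ≡-Reasoning

*-distribˡ-sumTo : ∀ n c (f : ℕ → ℚ) → c * sumTo n f ≡ sumTo n (λ i → c * f i)
*-distribˡ-sumTo zero c f = refl
*-distribˡ-sumTo (suc n) c f = trans (*-distribˡ-+ c (sumTo n f) (f (suc n)))
                                     (cong (_+ c * f (suc n)) (*-distribˡ-sumTo n c f))

*-distribʳ-sumTo : ∀ n c (f : ℕ → ℚ) → sumTo n f * c ≡ sumTo n (λ i → f i * c)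
*-distribʳ-sumTo n c f = trans (*-comm (sumTo n f) c)
  (trans (*-distribˡ-sumTo n c f) (sumTo-cong n (λ i → *-comm c (f i))))

sumTo-unfoldˡ : ∀ n (f : ℕ → ℚ) → sumTo (suc n) f ≡ f 0 + sumTo n (λ i → f (suc i))
sumTo-unfoldˡ zero f = refl
sumTo-unfoldˡ (suc n) f = trans (cong (_+ f (suc (suc n))) (sumTo-unfoldˡ n f))
                                (+-assoc (f 0) (sumTo n (λ i → f (suc i))) (f (suc (suc n))))

sumTo-reverse : ∀ n (f : ℕ → ℚ) → sumTo n f ≡ sumTo n (λ i → f (n ∸ i))
sumTo-reverse zero f = refl
sumTo-reverse (suc n) f = begin
  sumTo n f + f (suc n)                 ≡⟨ cong (_+ f (suc n)) (sumTo-reverse n f) ⟩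
  sumTo n (λ i → f (n ∸ i)) + f (suc n) ≡⟨ +-comm _ (f (suc n)) ⟩
  f (suc n) + sumTo n (λ i → f (n ∸ i)) ≡⟨ sym (sumTo-unfoldˡ n (λ i → f (suc n ∸ i))) ⟩
  sumTo (suc n) (λ i → f (suc n ∸ i))   ∎
  where open ≡-Reasoning

sumTo-comm : ∀ n k (f : ℕ → ℕ → ℚ) →
             sumTo n (λ i → sumTo k (f i)) ≡ sumTo k (λ j → sumTo n (λ i → f i j))
sumTo-comm zero k f = refl
sumTo-comm (suc n) k f = trans (cong (_+ sumTo k (f (suc n))) (sumTo-comm n k f))
                               (sym (sumTo-distrib-+ k (λ j → sumTo n (λ i → f i j)) (f (suc n))))

sumTo-triangle : ∀ n (h : ℕ → ℕ → ℚ) →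
  sumTo n (λ i → sumTo i (λ j → h j (i ∸ j))) ≡ sumTo n (λ a → sumTo (n ∸ a) (h a))
sumTo-triangle zero h = refl
sumTo-triangle (suc n) h = begin
  sumTo n (λ i → sumTo i (λ j → h j (i ∸ j))) + sumTo (suc n) (λ j → h j (suc n ∸ j))
    ≡⟨ cong (_+ sumTo (suc n) (λ j → h j (suc n ∸ j))) (sumTo-triangle n h) ⟩
  sumTo n (λ a → sumTo (n ∸ a) (h a)) + (sumTo n (λ j → h j (suc n ∸ j)) + h (suc n) (suc n ∸ suc n))
    ≡⟨ sym (+-assoc (sumTo n (λ a → sumTo (n ∸ a) (h a))) _ _) ⟩
  (sumTo n (λ a → sumTo (n ∸ a) (h a)) + sumTo n (λ j → h j (suc n ∸ j))) + h (suc n) (n ∸ n)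
    ≡⟨ cong₂ _+_ (sym (sumTo-distrib-+ n _ _)) (cong (h (suc n)) (ℕₚ.n∸n≡0 n)) ⟩
  sumTo n (λ a → sumTo (n ∸ a) (h a) + h a (suc n ∸ a)) + h (suc n) 0
    ≡⟨ cong (_+ h (suc n) 0) (sumTo-cong≤ n (λ a a≤n →
         trans (cong (λ m → sumTo (n ∸ a) (h a) + h a m) (ℕₚ.+-∸-assoc 1 a≤n))
               (cong (λ m → sumTo m (h a)) (sym (ℕₚ.+-∸-assoc 1 a≤n))))) ⟩
  sumTo n (λ a → sumTo (suc n ∸ a) (h a)) + sumTo 0 (h (suc n))
    ≡⟨ cong (λ m → sumTo n (λ a → sumTo (suc n ∸ a) (h a)) + sumTo m (h (suc n))) (sym (ℕₚ.n∸n≡0 n)) ⟩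
  sumTo (suc n) (λ a → sumTo (suc n ∸ a) (h a)) ∎
  where open ≡-Reasoning

sumTo-single : ∀ n a (f : ℕ → ℚ) → a ≤ n → (∀ i → i ≤ n → i ≢ a → f i ≡ 0ℚ) → sumTo n f ≡ f a
sumTo-single zero .zero f z≤n others≡0 = refl
sumTo-single (suc n) a f a≤1+n others≡0 with ℕₚ.m≤n⇒m<n∨m≡n a≤1+n
... | inj₂ refl =
  trans (cong (_+ f (suc n)) (sumTo-zero n (λ i i≤n → others≡0 i (ℕₚ.m≤n⇒m≤1+n i≤n) (ℕₚ.<⇒≢ (s≤s i≤n)))))
        (+-identityˡ (f (suc n)))
... | inj₁ (s≤s a≤n) =
  trans (cong₂ _+_ (sumTo-single n a f a≤n (λ i i≤n → others≡0 i (ℕₚ.m≤n⇒m≤1+n i≤n)))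
                   (others≡0 (suc n) ℕₚ.≤-refl (ℕₚ.>⇒≢ (s≤s a≤n))))
        (+-identityʳ (f a))

sumTo-extend : ∀ n m (f : ℕ → ℚ) → m ≤ n → (∀ i → m < i → i ≤ n → f i ≡ 0ℚ) → sumTo n f ≡ sumTo m f
sumTo-extend n m f m≤n tail≡0 with ℕₚ.m≤n⇒m<n∨m≡n m≤n
... | inj₂ refl = refl
sumTo-extend (suc n) m f _ tail≡0 | inj₁ (s≤s m≤n) =
  trans (cong₂ _+_ (sumTo-extend n m f m≤n (λ i m<i i≤n → tail≡0 i m<i (ℕₚ.m≤n⇒m≤1+n i≤n)))
                   (tail≡0 (suc n) (s≤s m≤n) ℕₚ.≤-refl))
        (+-identityʳ (sumTo m f))

-- Power series in z and u

infix 4 _≈_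
record _≈_ (A B : Series) : Set where
  constructor coefficientwise
  field
    coeff : ∀ n k → A n k ≡ B n k
open _≈_ public

≈-refl : ∀ {A} → A ≈ A
≈-refl .coeff n k = refl

≈-sym : ∀ {A B} → A ≈ B → B ≈ A
≈-sym A≈B .coeff n k = sym (A≈B .coeff n k)

≈-trans : ∀ {A B C} → A ≈ B → B ≈ C → A ≈ C
≈-trans A≈B B≈C .coeff n k = trans (A≈B .coeff n k) (B≈C .coeff n k)

⊕-cong : ∀ {A A′ B B′} → A ≈ A′ → B ≈ B′ → A ⊕ B ≈ A′ ⊕ B′
⊕-cong A≈A′ B≈B′ .coeff n k = cong₂ _+_ (A≈A′ .coeff n k) (B≈B′ .coeff n k)

⊖-cong : ∀ {A A′ B B′} → A ≈ A′ → B ≈ B′ → A ⊖ B ≈ A′ ⊖ B′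
⊖-cong A≈A′ B≈B′ .coeff n k = cong₂ _-_ (A≈A′ .coeff n k) (B≈B′ .coeff n k)

⊛-cong : ∀ {A A′ B B′} → A ≈ A′ → B ≈ B′ → A ⊛ B ≈ A′ ⊛ B′
⊛-cong A≈A′ B≈B′ .coeff n k =
  sumTo-cong n (λ i → sumTo-cong k (λ j → cong₂ _*_ (A≈A′ .coeff i j) (B≈B′ .coeff (n ∸ i) (k ∸ j))))

⊛-congˡ : ∀ A {B B′} → B ≈ B′ → A ⊛ B ≈ A ⊛ B′
⊛-congˡ A = ⊛-cong (≈-refl {A})

⊛-congʳ : ∀ {A A′} B → A ≈ A′ → A ⊛ B ≈ A′ ⊛ B
⊛-congʳ B A≈A′ = ⊛-cong A≈A′ (≈-refl {B})

scale-cong : ∀ c {A A′} → A ≈ A′ → scale c A ≈ scale c A′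
scale-cong c A≈A′ .coeff n k = cong (c *_) (A≈A′ .coeff n k)

⊛-comm : ∀ A B → A ⊛ B ≈ B ⊛ A
⊛-comm A B .coeff n k = trans (sumTo-reverse n row) (sumTo-cong≤ n reversed)
  where
  row : ℕ → ℚ
  row i = sumTo k (λ j → A i j * B (n ∸ i) (k ∸ j))
  reversed : ∀ i → i ≤ n → row (n ∸ i) ≡ sumTo k (λ j → B i j * A (n ∸ i) (k ∸ j))
  reversed i i≤n = trans (sumTo-reverse k _) (sumTo-cong≤ k (λ j j≤k →
    trans (cong₂ (λ i′ j′ → A (n ∸ i) (k ∸ j) * B i′ j′) (ℕₚ.m∸[m∸n]≡n i≤n) (ℕₚ.m∸[m∸n]≡n j≤k))
          (*-comm (A (n ∸ i) (k ∸ j)) (B i j))))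

private
  tripleProduct : Series → Series → Series → Series
  tripleProduct A B C n k =
    sumTo n (λ a → sumTo (n ∸ a) (λ b → sumTo k (λ c → sumTo (k ∸ c) (λ d →
      A a c * (B b d * C (n ∸ a ∸ b) (k ∸ c ∸ d))))))

  ⊛-assocʳ-expand : ∀ A B C → A ⊛ (B ⊛ C) ≈ tripleProduct A B C
  ⊛-assocʳ-expand A B C .coeff n k = begin
    sumTo n (λ a → sumTo k (λ c → A a c * sumTo (n ∸ a) (λ b → sumTo (k ∸ c) (λ d → BC a c b d))))
      ≡⟨ sumTo-cong n (λ a → sumTo-cong k (λ c → trans (*-distribˡ-sumTo (n ∸ a) (A a c) _)
                                                  (sumTo-cong (n ∸ a) (λ b → *-distribˡ-sumTo (k ∸ c) (A a c) _)))) ⟩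
    sumTo n (λ a → sumTo k (λ c → sumTo (n ∸ a) (λ b → sumTo (k ∸ c) (λ d → A a c * BC a c b d))))
      ≡⟨ sumTo-cong n (λ a → sumTo-comm k (n ∸ a) _) ⟩
    tripleProduct A B C n k ∎
    where
    open ≡-Reasoning
    BC : ℕ → ℕ → ℕ → ℕ → ℚ
    BC a c b d = B b d * C (n ∸ a ∸ b) (k ∸ c ∸ d)

  ⊛-assocˡ-expand : ∀ A B C → (A ⊛ B) ⊛ C ≈ tripleProduct A B C
  ⊛-assocˡ-expand A B C .coeff n k = begin
    sumTo n (λ i → sumTo k (λ j → sumTo i (λ a → sumTo j (λ c → A a c * B (i ∸ a) (j ∸ c))) * C (n ∸ i) (k ∸ j)))
      ≡⟨ sumTo-cong n (λ i → sumTo-cong k (λ j → trans (*-distribʳ-sumTo i _ _)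
                                                   (sumTo-cong i (λ a → *-distribʳ-sumTo j _ _)))) ⟩
    sumTo n (λ i → sumTo k (λ j → sumTo i (λ a → sumTo j (λ c → A a c * B (i ∸ a) (j ∸ c) * C (n ∸ i) (k ∸ j)))))
      ≡⟨ sumTo-cong n (λ i → sumTo-comm k i _) ⟩
    sumTo n (λ i → sumTo i (λ a → sumTo k (λ j → sumTo j (λ c → A a c * B (i ∸ a) (j ∸ c) * C (n ∸ i) (k ∸ j)))))
      ≡⟨ sumTo-cong≤ n (λ i _ → sumTo-cong≤ i (λ a a≤i → triangleᵏ i a a≤i)) ⟩
    sumTo n (λ i → sumTo i (λ a → H a (i ∸ a)))
      ≡⟨ sumTo-triangle n H ⟩
    sumTo n (λ a → sumTo (n ∸ a) (H a))
      ≡⟨ sumTo-cong n (λ a → sumTo-cong (n ∸ a) (λ b → sumTo-cong k (λ c → sumTo-cong (k ∸ c) (λ d → reassociate a b c d)))) ⟩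
    tripleProduct A B C n k ∎
    where
    open ≡-Reasoning
    H : ℕ → ℕ → ℚ
    H a b = sumTo k (λ c → sumTo (k ∸ c) (λ d → A a c * B b d * C (n ∸ (a ℕ.+ b)) (k ∸ (c ℕ.+ d))))
    triangleᵏ : ∀ i a → a ≤ i →
      sumTo k (λ j → sumTo j (λ c → A a c * B (i ∸ a) (j ∸ c) * C (n ∸ i) (k ∸ j))) ≡ H a (i ∸ a)
    triangleᵏ i a a≤i = begin
      sumTo k (λ j → sumTo j (λ c → A a c * B (i ∸ a) (j ∸ c) * C (n ∸ i) (k ∸ j)))
        ≡⟨ sumTo-cong≤ k (λ j _ → sumTo-cong≤ j (λ c c≤j →
             cong (λ m → A a c * B (i ∸ a) (j ∸ c) * C (n ∸ i) (k ∸ m)) (sym (ℕₚ.m+[n∸m]≡n c≤j)))) ⟩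
      sumTo k (λ j → sumTo j (λ c → A a c * B (i ∸ a) (j ∸ c) * C (n ∸ i) (k ∸ (c ℕ.+ (j ∸ c)))))
        ≡⟨ sumTo-triangle k (λ c d → A a c * B (i ∸ a) d * C (n ∸ i) (k ∸ (c ℕ.+ d))) ⟩
      sumTo k (λ c → sumTo (k ∸ c) (λ d → A a c * B (i ∸ a) d * C (n ∸ i) (k ∸ (c ℕ.+ d))))
        ≡⟨ cong (λ m → sumTo k (λ c → sumTo (k ∸ c) (λ d → A a c * B (i ∸ a) d * C (n ∸ m) (k ∸ (c ℕ.+ d)))))
                (sym (ℕₚ.m+[n∸m]≡n a≤i)) ⟩
      H a (i ∸ a) ∎
    reassociate : ∀ a b c d → A a c * B b d * C (n ∸ (a ℕ.+ b)) (k ∸ (c ℕ.+ d))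
                            ≡ A a c * (B b d * C (n ∸ a ∸ b) (k ∸ c ∸ d))
    reassociate a b c d =
      trans (cong₂ (λ x y → A a c * B b d * C x y) (sym (ℕₚ.∸-+-assoc n a b)) (sym (ℕₚ.∸-+-assoc k c d)))
            (*-assoc (A a c) (B b d) _)

⊛-assoc : ∀ A B C → (A ⊛ B) ⊛ C ≈ A ⊛ (B ⊛ C)
⊛-assoc A B C = ≈-trans (⊛-assocˡ-expand A B C) (≈-sym (⊛-assocʳ-expand A B C))

⊛-distribˡ-⊕ : ∀ A B C → A ⊛ (B ⊕ C) ≈ (A ⊛ B) ⊕ (A ⊛ C)
⊛-distribˡ-⊕ A B C .coeff n k = trans
  (sumTo-cong n (λ i → trans (sumTo-cong k (λ j → *-distribˡ-+ (A i j) _ _)) (sumTo-distrib-+ k _ _)))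
  (sumTo-distrib-+ n _ _)

⊛-distribˡ-⊖ : ∀ A B C → A ⊛ (B ⊖ C) ≈ (A ⊛ B) ⊖ (A ⊛ C)
⊛-distribˡ-⊖ A B C .coeff n k = trans
  (sumTo-cong n (λ i → trans (sumTo-cong k (λ j →
     solve 3 (λ a b c → a :* (b :- c) := a :* b :- a :* c) refl (A i j) _ _)) (sumTo-distrib-- k _ _)))
  (sumTo-distrib-- n _ _)

⊛-distribʳ-⊕ : ∀ A B C → (B ⊕ C) ⊛ A ≈ (B ⊛ A) ⊕ (C ⊛ A)
⊛-distribʳ-⊕ A B C =
  ≈-trans (⊛-comm (B ⊕ C) A) (≈-trans (⊛-distribˡ-⊕ A B C) (⊕-cong (⊛-comm A B) (⊛-comm A C)))

⊛-distribʳ-⊖ : ∀ A B C → (B ⊖ C) ⊛ A ≈ (B ⊛ A) ⊖ (C ⊛ A)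
⊛-distribʳ-⊖ A B C =
  ≈-trans (⊛-comm (B ⊖ C) A) (≈-trans (⊛-distribˡ-⊖ A B C) (⊖-cong (⊛-comm A B) (⊛-comm A C)))

⊛-scaleʳ : ∀ c A B → A ⊛ scale c B ≈ scale c (A ⊛ B)
⊛-scaleʳ c A B .coeff n k = sym (trans (*-distribˡ-sumTo n c _) (sumTo-cong n (λ i →
  trans (*-distribˡ-sumTo k c _) (sumTo-cong k (λ j →
    solve 3 (λ c a b → c :* (a :* b) := a :* (c :* b)) refl c (A i j) _)))))

⊛-scaleˡ : ∀ c A B → scale c A ⊛ B ≈ scale c (A ⊛ B)
⊛-scaleˡ c A B = ≈-trans (⊛-comm (scale c A) B) (≈-trans (⊛-scaleʳ c B A) (scale-cong c (⊛-comm B A)))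

zeroS : Series
zeroS _ _ = 0ℚ

⊛-zeroʳ : ∀ A → A ⊛ zeroS ≈ zeroS
⊛-zeroʳ A .coeff n k = sumTo-zero n (λ i _ → sumTo-zero k (λ j _ → *-zeroʳ (A i j)))

shift : ℚ → ℕ → ℕ → Series → Series
shift c a b B n k = if (a ≤ᵇ n) ∧ (b ≤ᵇ k) then c * B (n ∸ a) (k ∸ b) else 0ℚ

shift-cong : ∀ c a b {B B′} → B ≈ B′ → shift c a b B ≈ shift c a b B′
shift-cong c a b B≈B′ .coeff n k =
  cong (λ x → if (a ≤ᵇ n) ∧ (b ≤ᵇ k) then c * x else 0ℚ) (B≈B′ .coeff (n ∸ a) (k ∸ b))

≡ᵇ-refl : ∀ a → (a ≡ᵇ a) ≡ true
≡ᵇ-refl zero = refl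
≡ᵇ-refl (suc a) = ≡ᵇ-refl a

≢⇒≡ᵇ-false : ∀ i a → i ≢ a → (i ≡ᵇ a) ≡ false
≢⇒≡ᵇ-false i a i≢a with i ≡ᵇ a in eq
... | false = refl
... | true = ⊥-elim (i≢a (ℕₚ.≡ᵇ⇒≡ i a (subst T (sym eq) _)))

mono-diagonal : ∀ c a b → mono c a b a b ≡ c
mono-diagonal c a b rewrite ≡ᵇ-refl a | ≡ᵇ-refl b = refl

mono-offDiagonal : ∀ c a b i j → i ≢ a ⊎ j ≢ b → mono c a b i j ≡ 0ℚ
mono-offDiagonal c a b i j (inj₁ i≢a) rewrite ≢⇒≡ᵇ-false i a i≢a = refl
mono-offDiagonal c a b i j (inj₂ j≢b) rewrite ≢⇒≡ᵇ-false j b j≢b | Bool.∧-zeroʳ (i ≡ᵇ a) = refl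

private
  mono-⊛-inRange : ∀ c a b B n k → (mono c a b ⊛ B) (a ℕ.+ n) (b ℕ.+ k) ≡ c * B n k
  mono-⊛-inRange c a b B n k = begin
    (mono c a b ⊛ B) (a ℕ.+ n) (b ℕ.+ k)
      ≡⟨ sumTo-single (a ℕ.+ n) a _ (ℕₚ.m≤m+n a n) (λ i _ i≢a → sumTo-zero (b ℕ.+ k) (λ j _ →
           vanish (mono-offDiagonal c a b i j (inj₁ i≢a)))) ⟩
    sumTo (b ℕ.+ k) (λ j → mono c a b a j * B (a ℕ.+ n ∸ a) (b ℕ.+ k ∸ j))
      ≡⟨ sumTo-single (b ℕ.+ k) b _ (ℕₚ.m≤m+n b k) (λ j _ j≢b →
           vanish (mono-offDiagonal c a b a j (inj₂ j≢b))) ⟩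
    mono c a b a b * B (a ℕ.+ n ∸ a) (b ℕ.+ k ∸ b)
      ≡⟨ cong₂ (λ x y → x * B y (b ℕ.+ k ∸ b)) (mono-diagonal c a b) (ℕₚ.m+n∸m≡n a n) ⟩
    c * B n (b ℕ.+ k ∸ b)
      ≡⟨ cong (λ y → c * B n y) (ℕₚ.m+n∸m≡n b k) ⟩
    c * B n k ∎
    where
    open ≡-Reasoning
    vanish : ∀ {x} {y} → x ≡ 0ℚ → x * y ≡ 0ℚ
    vanish {y = y} refl = *-zeroˡ y

  mono-⊛-outOfRange : ∀ c a b B n k → n < a ⊎ k < b → (mono c a b ⊛ B) n k ≡ 0ℚ
  mono-⊛-outOfRange c a b B n k out = sumTo-zero n (λ i i≤n → sumTo-zero k (λ j j≤k →
    trans (cong (_* B (n ∸ i) (k ∸ j)) (mono-offDiagonal c a b i j (offDiagonal out i≤n j≤k)))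
          (*-zeroˡ (B (n ∸ i) (k ∸ j)))))
    where
    offDiagonal : ∀ {i j} → n < a ⊎ k < b → i ≤ n → j ≤ k → i ≢ a ⊎ j ≢ b
    offDiagonal (inj₁ n<a) i≤n _ = inj₁ (ℕₚ.<⇒≢ (ℕₚ.≤-<-trans i≤n n<a))
    offDiagonal (inj₂ k<b) _ j≤k = inj₂ (ℕₚ.<⇒≢ (ℕₚ.≤-<-trans j≤k k<b))

mono-⊛ : ∀ c a b B → mono c a b ⊛ B ≈ shift c a b B
mono-⊛ c a b B .coeff n k with a ≤ᵇ n in a≤ᵇn | b ≤ᵇ k in b≤ᵇk
... | true | true = trans (cong₂ (mono c a b ⊛ B) (sym (ℕₚ.m+[n∸m]≡n a≤n)) (sym (ℕₚ.m+[n∸m]≡n b≤k)))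
                          (mono-⊛-inRange c a b B (n ∸ a) (k ∸ b))
  where
  a≤n : a ≤ n
  a≤n = ℕₚ.≤ᵇ⇒≤ a n (subst T (sym a≤ᵇn) _)
  b≤k : b ≤ k
  b≤k = ℕₚ.≤ᵇ⇒≤ b k (subst T (sym b≤ᵇk) _)
... | false | _ = mono-⊛-outOfRange c a b B n k (inj₁ (ℕₚ.≰⇒> (λ a≤n → subst T a≤ᵇn (ℕₚ.≤⇒≤ᵇ a≤n))))
... | true | false = mono-⊛-outOfRange c a b B n k (inj₂ (ℕₚ.≰⇒> (λ b≤k → subst T b≤ᵇk (ℕₚ.≤⇒≤ᵇ b≤k))))

oneS-⊛ : ∀ B → oneS ⊛ B ≈ B
oneS-⊛ B .coeff n k = trans (mono-⊛-inRange 1ℚ 0 0 B n k) (*-identityˡ _)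

⊛-oneS : ∀ B → B ⊛ oneS ≈ B
⊛-oneS B = ≈-trans (⊛-comm B oneS) (oneS-⊛ B)

⊛-commutativeMonoid : CommutativeMonoid 0ℓ 0ℓ
⊛-commutativeMonoid = record
  { Carrier = Series ; _≈_ = _≈_ ; _∙_ = _⊛_ ; ε = oneS
  ; isCommutativeMonoid = record
    { isMonoid = record
      { isSemigroup = record
        { isMagma = record
          { isEquivalence = record
            { refl = ≈-refl ; sym = ≈-sym ; trans = ≈-trans }
          ; ∙-cong = ⊛-cong }
        ; assoc = ⊛-assoc }
      ; identity = oneS-⊛ , ⊛-oneS }
    ; comm = ⊛-comm } }

module ⊛-Solver = CommutativeMonoidSolver ⊛-commutativeMonoid


module ≈-Reasoning = SetoidReasoning (CommutativeMonoid.setoid ⊛-commutativeMonoid)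

-- Derivative in z and the exponential

fromℕ : ℕ → ℚ
fromℕ zero = 0ℚ
fromℕ (suc m) = 1ℚ + fromℕ m

fromℕ-+ : ∀ a b → fromℕ (a ℕ.+ b) ≡ fromℕ a + fromℕ b
fromℕ-+ zero b = sym (+-identityˡ (fromℕ b))
fromℕ-+ (suc a) b = trans (cong (λ x → 1ℚ + x) (fromℕ-+ a b)) (sym (+-assoc 1ℚ (fromℕ a) (fromℕ b)))

private
  fromℕ≡mkℚ : ∀ m → fromℕ m ≡ mkℚ (+ m) 0 (Coprime.sym (Coprime.1-coprimeTo m))
  fromℕ≡mkℚ zero = refl
  -- The middle term is the unnormalised fraction that ℚ's addition computes for 1 + m/1.
  fromℕ≡mkℚ (suc m) = begin
    1ℚ + fromℕ m                          ≡⟨ cong (λ x → 1ℚ + x) (fromℕ≡mkℚ m) ⟩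
    (+ 1 ℤ.+ (Sign.+ ℤ.◃ (m ℕ.* 1))) / 1 ≡⟨ /-cong {q₁ = 1} {q₂ = 1} (numerator m) refl ⟩
    + suc m / 1                           ≡⟨ normalize-coprime (Coprime.sym (Coprime.1-coprimeTo (suc m))) ⟩
    mkℚ (+ suc m) 0 _                     ∎
    where
    open ≡-Reasoning
    numerator : ∀ m → + 1 ℤ.+ (Sign.+ ℤ.◃ (m ℕ.* 1)) ≡ + suc m
    numerator m rewrite ℕₚ.*-identityʳ m with m
    ... | zero = refl
    ... | suc _ = refl

fromℕ-suc-*-inverse : ∀ n → fromℕ (suc n) * (+ 1 / suc n) ≡ 1ℚ
fromℕ-suc-*-inverse n = trans (cong₂ _*_ (fromℕ≡mkℚ (suc n)) (normalize-coprime (Coprime.1-coprimeTo (suc n))))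
                              (*-inverseʳ (mkℚ (+ suc n) 0 (Coprime.sym (Coprime.1-coprimeTo (suc n)))))

fromℕ-suc-*-cancelˡ : ∀ n {x y} → fromℕ (suc n) * x ≡ fromℕ (suc n) * y → x ≡ y
fromℕ-suc-*-cancelˡ n {x} {y} eq = begin
  x               ≡⟨ sym (*-identityˡ x) ⟩
  1ℚ * x          ≡⟨ cong (_* x) (sym (fromℕ-suc-*-inverse n)) ⟩
  (a * w) * x     ≡⟨ solve 3 (λ a w x → (a :* w) :* x := w :* (a :* x)) refl a w x ⟩
  w * (a * x)     ≡⟨ cong (w *_) eq ⟩
  w * (a * y)     ≡⟨ solve 3 (λ a w y → w :* (a :* y) := (a :* w) :* y) refl a w y ⟩
  (a * w) * y     ≡⟨ cong (_* y) (fromℕ-suc-*-inverse n) ⟩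
  1ℚ * y          ≡⟨ *-identityˡ y ⟩
  y               ∎
  where
  open ≡-Reasoning
  a w : ℚ
  a = fromℕ (suc n)
  w = + 1 / suc n

∂ : Series → Series
∂ A n k = fromℕ (suc n) * A (suc n) k

∂-oneS : ∂ oneS ≈ zeroS
∂-oneS .coeff n k = *-zeroʳ (fromℕ (suc n))

∂-scale : ∀ c A → ∂ (scale c A) ≈ scale c (∂ A)
∂-scale c A .coeff n k = solve 3 (λ a c x → a :* (c :* x) := c :* (a :* x)) refl (fromℕ (suc n)) c (A (suc n) k)

∂-integrate : ∀ A → ∂ (integrate A) ≈ A
∂-integrate A .coeff n k = begin
  fromℕ (suc n) * (A n k * (+ 1 / suc n))
    ≡⟨ solve 3 (λ a x w → a :* (x :* w) := (a :* w) :* x) refl (fromℕ (suc n)) (A n k) (+ 1 / suc n) ⟩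
  (fromℕ (suc n) * (+ 1 / suc n)) * A n k ≡⟨ cong (_* A n k) (fromℕ-suc-*-inverse n) ⟩
  1ℚ * A n k                              ≡⟨ *-identityˡ _ ⟩
  A n k                                   ∎
  where open ≡-Reasoning

∂≈zeroS⇒vanishes : ∀ F → ∂ F ≈ zeroS → ∀ n k → F (suc n) k ≡ 0ℚ
∂≈zeroS⇒vanishes F ∂F≈0 n k =
  fromℕ-suc-*-cancelˡ n (trans (∂F≈0 .coeff n k) (sym (*-zeroʳ (fromℕ (suc n)))))

-- The weight n + 1 of the coefficient of z^(n+1) in A ⊛ B splits as i + (n + 1 − i)
-- between the two factors.
∂-⊛ : ∀ A B → ∂ (A ⊛ B) ≈ (∂ A ⊛ B) ⊕ (A ⊛ ∂ B)
∂-⊛ A B .coeff n k = begin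
  fromℕ (suc n) * sumTo (suc n) (λ i → sumTo k (term i))
    ≡⟨ trans (*-distribˡ-sumTo (suc n) (fromℕ (suc n)) _) (sumTo-cong (suc n) (λ i → *-distribˡ-sumTo k (fromℕ (suc n)) (term i))) ⟩
  sumTo (suc n) (λ i → sumTo k (λ j → fromℕ (suc n) * term i j))
    ≡⟨ sumTo-cong≤ (suc n) (λ i i≤1+n → sumTo-cong k (split i i≤1+n)) ⟩
  sumTo (suc n) (λ i → sumTo k (λ j → fromℕ i * term i j + fromℕ (suc n ∸ i) * term i j))
    ≡⟨ trans (sumTo-cong (suc n) (λ i → sumTo-distrib-+ k _ _)) (sumTo-distrib-+ (suc n) _ _) ⟩
  sumTo (suc n) leftWeighted + sumTo (suc n) rightWeighted
    ≡⟨ cong₂ _+_ leftPart rightPart ⟩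
  (∂ A ⊛ B) n k + (A ⊛ ∂ B) n k ∎
  where
  open ≡-Reasoning
  term : ℕ → ℕ → ℚ
  term i j = A i j * B (suc n ∸ i) (k ∸ j)
  leftWeighted rightWeighted : ℕ → ℚ
  leftWeighted i = sumTo k (λ j → fromℕ i * term i j)
  rightWeighted i = sumTo k (λ j → fromℕ (suc n ∸ i) * term i j)
  split : ∀ i → i ≤ suc n → ∀ j → fromℕ (suc n) * term i j ≡ fromℕ i * term i j + fromℕ (suc n ∸ i) * term i j
  split i i≤1+n j = trans (cong (λ m → fromℕ m * term i j) (sym (ℕₚ.m+[n∸m]≡n i≤1+n)))
    (trans (cong (_* term i j) (fromℕ-+ i (suc n ∸ i))) (*-distribʳ-+ (term i j) (fromℕ i) (fromℕ (suc n ∸ i))))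
  leftPart : sumTo (suc n) leftWeighted ≡ (∂ A ⊛ B) n k
  leftPart = begin
    sumTo (suc n) leftWeighted                          ≡⟨ sumTo-unfoldˡ n leftWeighted ⟩
    leftWeighted 0 + sumTo n (λ i → leftWeighted (suc i))
      ≡⟨ cong (_+ sumTo n (λ i → leftWeighted (suc i))) (sumTo-zero k (λ j _ → *-zeroˡ (term 0 j))) ⟩
    0ℚ + sumTo n (λ i → leftWeighted (suc i))           ≡⟨ +-identityˡ _ ⟩
    sumTo n (λ i → leftWeighted (suc i))
      ≡⟨ sumTo-cong n (λ i → sumTo-cong k (λ j → sym (*-assoc (fromℕ (suc i)) (A (suc i) j) _))) ⟩
    (∂ A ⊛ B) n k                                       ∎
  rightPart : sumTo (suc n) rightWeighted ≡ (A ⊛ ∂ B) n k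
  rightPart = begin
    sumTo n rightWeighted + rightWeighted (suc n)
      ≡⟨ cong (λ x → sumTo n rightWeighted + x) (sumTo-zero k (λ j _ →
           trans (cong (λ m → fromℕ m * term (suc n) j) (ℕₚ.n∸n≡0 n)) (*-zeroˡ (term (suc n) j)))) ⟩
    sumTo n rightWeighted + 0ℚ ≡⟨ +-identityʳ _ ⟩
    sumTo n rightWeighted
      ≡⟨ sumTo-cong≤ n (λ i i≤n → sumTo-cong k (λ j →
           trans (cong (λ m → fromℕ m * (A i j * B m (k ∸ j))) (ℕₚ.+-∸-assoc 1 i≤n))
                 (solve 3 (λ c a b → c :* (a :* b) := a :* (c :* b)) refl (fromℕ (suc (n ∸ i))) (A i j) _))) ⟩
    (A ⊛ ∂ B) n k ∎

^S-cong : ∀ {A B} → A ≈ B → ∀ m → A ^S m ≈ B ^S m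
^S-cong A≈B zero = ≈-refl
^S-cong A≈B (suc m) = ⊛-cong A≈B (^S-cong A≈B m)

expS-cong : ∀ {A B} → A ≈ B → expS A ≈ expS B
expS-cong A≈B .coeff n k = sumTo-cong n (λ m → cong (invFact m *_) (^S-cong A≈B m .coeff n k))

NoZ⁰Terms : Series → Set
NoZ⁰Terms A = ∀ k → A 0 k ≡ 0ℚ

^S-vanishes-below : ∀ A → NoZ⁰Terms A → ∀ m n k → n < m → (A ^S m) n k ≡ 0ℚ
^S-vanishes-below A A₀≡0 (suc m) n k n<1+m = sumTo-zero n (λ i i≤n → sumTo-zero k (λ j _ → term i i≤n j))
  where
  term : ∀ i → i ≤ n → ∀ j → A i j * (A ^S m) (n ∸ i) (k ∸ j) ≡ 0ℚ
  term zero _ j = trans (cong (_* (A ^S m) n (k ∸ j)) (A₀≡0 j)) (*-zeroˡ ((A ^S m) n (k ∸ j)))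
  term (suc i) 1+i≤n j = trans (cong (A (suc i) j *_) (^S-vanishes-below A A₀≡0 m (n ∸ suc i) (k ∸ j) (lower 1+i≤n n<1+m)))
                               (*-zeroʳ (A (suc i) j))
    where
    lower : ∀ {n} → suc i ≤ n → n < suc m → n ∸ suc i < m
    lower {suc n} _ (s≤s n<m) = ℕₚ.≤-<-trans (ℕₚ.m∸n≤m n i) n<m

∂-^S : ∀ A m → ∂ (A ^S suc m) ≈ scale (fromℕ (suc m)) (∂ A ⊛ A ^S m)
∂-^S A zero .coeff n k = begin
  ∂ (A ⊛ oneS) n k                            ≡⟨ ∂-⊛ A oneS .coeff n k ⟩
  (∂ A ⊛ oneS) n k + (A ⊛ ∂ oneS) n k
    ≡⟨ cong (λ t → (∂ A ⊛ oneS) n k + t) (trans (⊛-congˡ A ∂-oneS .coeff n k) (⊛-zeroʳ A .coeff n k)) ⟩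
  (∂ A ⊛ oneS) n k + 0ℚ
    ≡⟨ solve 1 (λ x → x :+ con 0ℚ := (con 1ℚ :+ con 0ℚ) :* x) refl ((∂ A ⊛ oneS) n k) ⟩
  fromℕ 1 * (∂ A ⊛ oneS) n k                  ∎
  where open ≡-Reasoning
∂-^S A (suc m) .coeff n k = begin
  ∂ (A ⊛ A ^S suc m) n k                                      ≡⟨ ∂-⊛ A (A ^S suc m) .coeff n k ⟩
  X + (A ⊛ ∂ (A ^S suc m)) n k
    ≡⟨ cong (λ t → X + t) (trans (⊛-congˡ A (∂-^S A m) .coeff n k) (⊛-scaleʳ (fromℕ (suc m)) A (∂ A ⊛ A ^S m) .coeff n k)) ⟩
  X + fromℕ (suc m) * (A ⊛ (∂ A ⊛ A ^S m)) n k
    ≡⟨ cong (λ t → X + fromℕ (suc m) * t) (exchange .coeff n k) ⟩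
  X + fromℕ (suc m) * X
    ≡⟨ solve 2 (λ x c → x :+ c :* x := (con 1ℚ :+ c) :* x) refl X (fromℕ (suc m)) ⟩
  fromℕ (suc (suc m)) * X                                     ∎
  where
  open ≡-Reasoning
  open ⊛-Solver using (_⊜_) renaming (solve to ⊛-solve; _⊕_ to _∙_)
  X : ℚ
  X = (∂ A ⊛ A ^S suc m) n k
  exchange : A ⊛ (∂ A ⊛ A ^S m) ≈ ∂ A ⊛ (A ⊛ A ^S m)
  exchange = ⊛-solve 3 (λ a b c → a ∙ (b ∙ c) ⊜ b ∙ (a ∙ c)) ≈-refl A (∂ A) (A ^S m)

expS-extend : ∀ A → NoZ⁰Terms A → ∀ N n k → n ≤ N → expS A n k ≡ sumTo N (λ m → invFact m * (A ^S m) n k)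
expS-extend A A₀≡0 N n k n≤N = sym (sumTo-extend N n _ n≤N (λ m n<m _ →
  trans (cong (invFact m *_) (^S-vanishes-below A A₀≡0 m n k n<m)) (*-zeroʳ (invFact m))))

∂-expS : ∀ A → NoZ⁰Terms A → ∂ (expS A) ≈ ∂ A ⊛ expS A
∂-expS A A₀≡0 .coeff n k = trans termwise (sym productExpanded)
  where
  open ≡-Reasoning
  S : ℚ
  S = sumTo n (λ m → invFact m * (∂ A ⊛ A ^S m) n k)
  ∂-term : ∀ m → invFact (suc m) * ∂ (A ^S suc m) n k ≡ invFact m * (∂ A ⊛ A ^S m) n k
  ∂-term m = begin
    invFact (suc m) * ∂ (A ^S suc m) n k  ≡⟨ cong (invFact (suc m) *_) (∂-^S A m .coeff n k) ⟩
    (invFact m * w) * (fromℕ (suc m) * y)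
      ≡⟨ solve 4 (λ f w c y → (f :* w) :* (c :* y) := f :* ((c :* w) :* y)) refl (invFact m) w (fromℕ (suc m)) y ⟩
    invFact m * ((fromℕ (suc m) * w) * y) ≡⟨ cong (λ t → invFact m * (t * y)) (fromℕ-suc-*-inverse m) ⟩
    invFact m * (1ℚ * y)                  ≡⟨ cong (invFact m *_) (*-identityˡ y) ⟩
    invFact m * y                         ∎
    where
    w y : ℚ
    w = + 1 / suc m
    y = (∂ A ⊛ A ^S m) n k
  termwise : ∂ (expS A) n k ≡ S
  termwise = begin
    fromℕ (suc n) * sumTo (suc n) (λ m → invFact m * (A ^S m) (suc n) k)
      ≡⟨ *-distribˡ-sumTo (suc n) (fromℕ (suc n)) _ ⟩
    sumTo (suc n) (λ m → fromℕ (suc n) * (invFact m * (A ^S m) (suc n) k))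
      ≡⟨ sumTo-cong (suc n) (λ m → solve 3 (λ c f x → c :* (f :* x) := f :* (c :* x)) refl
                                          (fromℕ (suc n)) (invFact m) ((A ^S m) (suc n) k)) ⟩
    sumTo (suc n) (λ m → invFact m * ∂ (A ^S m) n k)
      ≡⟨ sumTo-unfoldˡ n _ ⟩
    invFact 0 * ∂ oneS n k + sumTo n (λ m → invFact (suc m) * ∂ (A ^S suc m) n k)
      ≡⟨ cong₂ _+_ (trans (cong (invFact 0 *_) (∂-oneS .coeff n k)) (*-zeroʳ (invFact 0))) (sumTo-cong n ∂-term) ⟩
    0ℚ + S ≡⟨ +-identityˡ S ⟩
    S      ∎
  productExpanded : (∂ A ⊛ expS A) n k ≡ S
  productExpanded = begin
    (∂ A ⊛ expS A) n k
      ≡⟨ sumTo-cong≤ n (λ i _ → sumTo-cong k (λ j → cong (∂ A i j *_) (expS-extend A A₀≡0 n (n ∸ i) (k ∸ j) (ℕₚ.m∸n≤m n i)))) ⟩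
    sumTo n (λ i → sumTo k (λ j → ∂ A i j * sumTo n (λ m → invFact m * (A ^S m) (n ∸ i) (k ∸ j))))
      ≡⟨ sumTo-cong n (λ i → sumTo-cong k (λ j → trans (*-distribˡ-sumTo n (∂ A i j) _) (sumTo-cong n (λ m →
            solve 3 (λ d f x → d :* (f :* x) := f :* (d :* x)) refl (∂ A i j) (invFact m) ((A ^S m) (n ∸ i) (k ∸ j)))))) ⟩
    sumTo n (λ i → sumTo k (λ j → sumTo n (λ m → invFact m * (∂ A i j * (A ^S m) (n ∸ i) (k ∸ j)))))
      ≡⟨ sumTo-cong n (λ i → sumTo-comm k n _) ⟩
    sumTo n (λ i → sumTo n (λ m → sumTo k (λ j → invFact m * (∂ A i j * (A ^S m) (n ∸ i) (k ∸ j)))))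
      ≡⟨ sumTo-comm n n _ ⟩
    sumTo n (λ m → sumTo n (λ i → sumTo k (λ j → invFact m * (∂ A i j * (A ^S m) (n ∸ i) (k ∸ j)))))
      ≡⟨ sym (sumTo-cong n (λ m → trans (*-distribˡ-sumTo n (invFact m) _) (sumTo-cong n (λ i → *-distribˡ-sumTo k (invFact m) _)))) ⟩
    S ∎

expS-⊛-expS-neg : ∀ A → NoZ⁰Terms A → expS A ⊛ expS (scale (- 1ℚ) A) ≈ oneS
expS-⊛-expS-neg A A₀≡0 .coeff zero k =
  trans (sumTo-cong k (λ j → cong₂ _*_ (*-identityˡ (oneS 0 j)) (*-identityˡ (oneS 0 (k ∸ j)))))
        (oneS-⊛ oneS .coeff 0 k)
expS-⊛-expS-neg A A₀≡0 .coeff (suc n) k = ∂≈zeroS⇒vanishes (eA ⊛ eB) derivativeVanishes n k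
  where
  B eA eB : Series
  B = scale (- 1ℚ) A
  eA = expS A
  eB = expS B
  B₀≡0 : NoZ⁰Terms B
  B₀≡0 k = trans (cong (- 1ℚ *_) (A₀≡0 k)) (*-zeroʳ (- 1ℚ))
  derivativeVanishes : ∂ (eA ⊛ eB) ≈ zeroS
  derivativeVanishes = begin
    ∂ (eA ⊛ eB)                                   ≈⟨ ∂-⊛ eA eB ⟩
    (∂ eA ⊛ eB) ⊕ (eA ⊛ ∂ eB)
      ≈⟨ ⊕-cong (⊛-congʳ eB (∂-expS A A₀≡0)) (⊛-congˡ eA (∂-expS B B₀≡0)) ⟩
    ((∂ A ⊛ eA) ⊛ eB) ⊕ (eA ⊛ (∂ B ⊛ eB))
      ≈⟨ ⊕-cong (⊛-assoc (∂ A) eA eB) (⊛-congˡ eA (⊛-congʳ eB (∂-scale (- 1ℚ) A))) ⟩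
    X ⊕ (eA ⊛ (scale (- 1ℚ) (∂ A) ⊛ eB))
      ≈⟨ ⊕-cong (≈-refl {X}) (≈-trans (⊛-congˡ eA (⊛-scaleˡ (- 1ℚ) (∂ A) eB)) (⊛-scaleʳ (- 1ℚ) eA (∂ A ⊛ eB))) ⟩
    X ⊕ scale (- 1ℚ) (eA ⊛ (∂ A ⊛ eB))            ≈⟨ ⊕-cong (≈-refl {X}) (scale-cong (- 1ℚ) exchange) ⟩
    X ⊕ scale (- 1ℚ) X
      ≈⟨ coefficientwise (λ n k → solve 1 (λ x → x :+ (:- con 1ℚ) :* x := con 0ℚ) refl (X n k)) ⟩
    zeroS                                         ∎
    where
    open ≈-Reasoning
    open ⊛-Solver using (_⊜_) renaming (solve to ⊛-solve; _⊕_ to _∙_)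
    X : Series
    X = ∂ A ⊛ (eA ⊛ eB)
    exchange : eA ⊛ (∂ A ⊛ eB) ≈ X
    exchange = ⊛-solve 3 (λ a b c → a ∙ (b ∙ c) ⊜ b ∙ (a ∙ c)) ≈-refl eA (∂ A) eB

-- The right-hand side solves (1 − uz) ∂F = (uz/2) F + P/(1 − z)

½ : ℚ
½ = + 1 / 2

∂-cz : ∀ c → ∂ (mono c 1 0) ≈ mono c 0 0
∂-cz c .coeff zero k = *-identityˡ _
∂-cz c .coeff (suc n) k = *-zeroʳ (fromℕ (suc (suc n)))

∂-L : ∂ L ≈ scale ½ geomUZ
∂-L .coeff n k with n ≡ᵇ k
... | true = begin
  fromℕ (suc n) * (- ½ * - (+ 1 / suc n))
    ≡⟨ solve 3 (λ a h w → a :* (:- h :* :- w) := h :* (a :* w)) refl (fromℕ (suc n)) ½ (+ 1 / suc n) ⟩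
  ½ * (fromℕ (suc n) * (+ 1 / suc n)) ≡⟨ cong (½ *_) (fromℕ-suc-*-inverse n) ⟩
  ½ * 1ℚ ∎
  where open ≡-Reasoning
... | false = solve 2 (λ a h → a :* (:- h :* con 0ℚ) := h :* con 0ℚ) refl (fromℕ (suc n)) ½

oneMinusUZ : Series
oneMinusUZ = oneS ⊖ mono 1ℚ 1 1

oneMinusUZ-⊛ : ∀ F → oneMinusUZ ⊛ F ≈ F ⊖ shift 1ℚ 1 1 F
oneMinusUZ-⊛ F = ≈-trans (⊛-distribʳ-⊖ F oneS (mono 1ℚ 1 1)) (⊖-cong (oneS-⊛ F) (mono-⊛ 1ℚ 1 1 F))

oneMinusUZ-⊛-geomUZ : oneMinusUZ ⊛ geomUZ ≈ oneS
oneMinusUZ-⊛-geomUZ .coeff n k = trans (oneMinusUZ-⊛ geomUZ .coeff n k) (telescope n k)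
  where
  telescope : ∀ n k → (geomUZ ⊖ shift 1ℚ 1 1 geomUZ) n k ≡ oneS n k
  telescope zero zero = refl
  telescope zero (suc k) = refl
  telescope (suc n) zero = refl
  telescope (suc n) (suc k) = solve 1 (λ g → g :- con 1ℚ :* g := con 0ℚ) refl (geomUZ n k)

logDerivE : Series
logDerivE = mono (- ½) 0 0 ⊕ scale ½ geomUZ

oneMinusUZ-⊛-logDerivE : oneMinusUZ ⊛ logDerivE ≈ mono ½ 1 1
oneMinusUZ-⊛-logDerivE .coeff n k = trans (oneMinusUZ-⊛ logDerivE .coeff n k) (telescope n k)
  where
  cancel : ∀ g → (0ℚ + ½ * g) - 1ℚ * (0ℚ + ½ * g) ≡ 0ℚ
  cancel = solve 1 (λ g → (con 0ℚ :+ con ½ :* g) :- con 1ℚ :* (con 0ℚ :+ con ½ :* g) := con 0ℚ) refl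
  telescope : ∀ n k → (logDerivE ⊖ shift 1ℚ 1 1 logDerivE) n k ≡ mono ½ 1 1 n k
  telescope zero zero = refl
  telescope zero (suc k) = refl
  telescope (suc zero) zero = refl
  telescope (suc (suc n)) zero = refl
  telescope (suc zero) (suc zero) = refl
  telescope (suc zero) (suc (suc k)) = cancel (geomUZ 0 (suc k))
  telescope (suc (suc n)) (suc k) = cancel (geomUZ (suc n) k)

E : Series
E = expCZ (- ½) ⊛ pow1mUZ-neg

∂-E : ∂ E ≈ logDerivE ⊛ E
∂-E = begin
  ∂ (Em ⊛ X)                                            ≈⟨ ∂-⊛ Em X ⟩
  (∂ Em ⊛ X) ⊕ (Em ⊛ ∂ X)
    ≈⟨ ⊕-cong (⊛-congʳ X (≈-trans (∂-expS (mono (- ½) 1 0) (λ _ → refl)) (⊛-congʳ Em (∂-cz (- ½)))))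
              (⊛-congˡ Em (≈-trans (∂-expS L (λ _ → refl)) (⊛-congʳ X ∂-L))) ⟩
  ((mono (- ½) 0 0 ⊛ Em) ⊛ X) ⊕ (Em ⊛ (scale ½ geomUZ ⊛ X))
    ≈⟨ ⊕-cong (⊛-assoc (mono (- ½) 0 0) Em X) (⊛-solve 3 (λ a b c → a ∙ (b ∙ c) ⊜ b ∙ (a ∙ c)) ≈-refl Em (scale ½ geomUZ) X) ⟩
  (mono (- ½) 0 0 ⊛ E) ⊕ (scale ½ geomUZ ⊛ E)
    ≈⟨ ≈-sym (⊛-distribʳ-⊕ E (mono (- ½) 0 0) (scale ½ geomUZ)) ⟩
  logDerivE ⊛ E                                         ∎
  where
  open ≈-Reasoning
  open ⊛-Solver using (_⊜_) renaming (solve to ⊛-solve; _⊕_ to _∙_)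
  Em X : Series
  Em = expCZ (- ½)
  X = pow1mUZ-neg

expCZ-inverse : expCZ ½ ⊛ expCZ (- ½) ≈ oneS
expCZ-inverse = ≈-trans (⊛-congˡ (expCZ ½) (expS-cong negate)) (expS-⊛-expS-neg (mono ½ 1 0) (λ _ → refl))
  where
  negate : mono (- ½) 1 0 ≈ scale (- 1ℚ) (mono ½ 1 0)
  negate .coeff n k with (n ≡ᵇ 1) ∧ (k ≡ᵇ 0)
  ... | true = refl
  ... | false = refl

pow1mUZ-inverse : pow1mUZ-neg ⊛ expS (scale (- 1ℚ) L) ≈ oneS
pow1mUZ-inverse = expS-⊛-expS-neg L (λ _ → refl)

RHS-ode : oneMinusUZ ⊛ ∂ RHS ≈ (mono ½ 1 1 ⊛ RHS) ⊕ (P ⊛ geomZ)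
RHS-ode = begin
  K ⊛ ∂ (E ⊛ I)                                 ≈⟨ ⊛-congˡ K (∂-⊛ E I) ⟩
  K ⊛ ((∂ E ⊛ I) ⊕ (E ⊛ ∂ I))
    ≈⟨ ⊛-congˡ K (⊕-cong (⊛-congʳ I ∂-E) (⊛-congˡ E (∂-integrate W))) ⟩
  K ⊛ (((logDerivE ⊛ E) ⊛ I) ⊕ (E ⊛ W))         ≈⟨ ⊛-distribˡ-⊕ K ((logDerivE ⊛ E) ⊛ I) (E ⊛ W) ⟩
  (K ⊛ ((logDerivE ⊛ E) ⊛ I)) ⊕ (K ⊛ (E ⊛ W))
    ≈⟨ ⊕-cong (⊛-solve 4 (λ k l e i → k ∙ ((l ∙ e) ∙ i) ⊜ (k ∙ l) ∙ (e ∙ i)) ≈-refl K logDerivE E I)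
              (⊛-solve 8 (λ k em x p ep gz y gu → k ∙ ((em ∙ x) ∙ (((p ∙ ep) ∙ gz) ∙ (y ∙ gu)))
                                              ⊜ ((ep ∙ em) ∙ (x ∙ y)) ∙ ((k ∙ gu) ∙ (p ∙ gz)))
                     ≈-refl K (expCZ (- ½)) pow1mUZ-neg P (expCZ ½) geomZ Y geomUZ) ⟩
  ((K ⊛ logDerivE) ⊛ RHS) ⊕ (((expCZ ½ ⊛ expCZ (- ½)) ⊛ (pow1mUZ-neg ⊛ Y)) ⊛ ((K ⊛ geomUZ) ⊛ (P ⊛ geomZ)))
    ≈⟨ ⊕-cong (⊛-congʳ RHS oneMinusUZ-⊛-logDerivE)
              (⊛-cong (⊛-cong expCZ-inverse pow1mUZ-inverse) (⊛-congʳ (P ⊛ geomZ) oneMinusUZ-⊛-geomUZ)) ⟩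
  (mono ½ 1 1 ⊛ RHS) ⊕ ((oneS ⊛ oneS) ⊛ (oneS ⊛ (P ⊛ geomZ)))
    ≈⟨ ⊕-cong (≈-refl {mono ½ 1 1 ⊛ RHS}) (⊛-solve 1 (λ q → (id ∙ id) ∙ (id ∙ q) ⊜ q) ≈-refl (P ⊛ geomZ)) ⟩
  (mono ½ 1 1 ⊛ RHS) ⊕ (P ⊛ geomZ)              ∎
  where
  open ≈-Reasoning
  open ⊛-Solver using (_⊜_; id) renaming (solve to ⊛-solve; _⊕_ to _∙_)
  K Y W I : Series
  K = oneMinusUZ
  Y = expS (scale (- 1ℚ) L)
  W = P ⊛ expCZ ½ ⊛ geomZ ⊛ pow1mUZ-pos-minus1
  I = integrate W

-- The coefficients of P/(1 − z)

uPower : ℕ → Series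
uPower zero = oneS
uPower (suc m) = shift 1ℚ 0 1 (uPower m)

zShift : ℕ → Series → Series
zShift zero B = B
zShift (suc a) B = shift 1ℚ 1 0 (zShift a B)

u^S≈uPower : ∀ m → u ^S m ≈ uPower m
u^S≈uPower zero = ≈-refl
u^S≈uPower (suc m) = ≈-trans (⊛-congˡ u (u^S≈uPower m)) (mono-⊛ 1ℚ 0 1 (uPower m))

z^S-⊛≈zShift : ∀ a B → (z ^S a) ⊛ B ≈ zShift a B
z^S-⊛≈zShift zero B = oneS-⊛ B
z^S-⊛≈zShift (suc a) B =
  ≈-trans (⊛-assoc z (z ^S a) B) (≈-trans (mono-⊛ 1ℚ 1 0 ((z ^S a) ⊛ B)) (shift-cong 1ℚ 1 0 (z^S-⊛≈zShift a B)))

private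
  cofactor cofactorExpanded : Series
  cofactor = u ⊕ (z ⊛ (u ^S 2)) ⊕ scale (+ 1 / 4) ((z ^S 2) ⊛ (u ^S 2)) ⊕ scale (+ 1 / 4) ((z ^S 2) ⊛ (u ^S 3))
  cofactorExpanded =
    uPower 1 ⊕ zShift 1 (uPower 2) ⊕ scale (+ 1 / 4) (zShift 2 (uPower 2)) ⊕ scale (+ 1 / 4) (zShift 2 (uPower 3))

  z^S-⊛-u^S : ∀ a m → (z ^S a) ⊛ (u ^S m) ≈ zShift a (uPower m)
  z^S-⊛-u^S a m = ≈-trans (⊛-congˡ (z ^S a) (u^S≈uPower m)) (z^S-⊛≈zShift a (uPower m))

  cofactor≈ : cofactor ≈ cofactorExpanded
  cofactor≈ = ⊕-cong (⊕-cong (⊕-cong (≈-trans (≈-sym (⊛-oneS u)) (mono-⊛ 1ℚ 0 1 oneS))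
                                     (≈-trans (⊛-congʳ (u ^S 2) (≈-sym (⊛-oneS z))) (z^S-⊛-u^S 1 2)))
                             (scale-cong (+ 1 / 4) (z^S-⊛-u^S 2 2)))
                     (scale-cong (+ 1 / 4) (z^S-⊛-u^S 2 3))

-- P with every product by a power of z or u replaced by a shift, so that its coefficients compute.
Pexpanded : Series
Pexpanded = (cofactorExpanded ⊖ shift 1ℚ 1 0 cofactorExpanded) ⊕ scale ½ (zShift 3 (uPower 2))

P≈Pexpanded : P ≈ Pexpanded
P≈Pexpanded = ⊕-cong
  (≈-trans (⊛-distribʳ-⊖ cofactor oneS z)
           (⊖-cong (≈-trans (oneS-⊛ cofactor) cofactor≈)
                   (≈-trans (mono-⊛ 1ℚ 1 0 cofactor) (shift-cong 1ℚ 1 0 cofactor≈))))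
  (scale-cong ½ (z^S-⊛-u^S 3 2))

PgeomZ-coeff : ℕ → ℕ → ℚ
PgeomZ-coeff 0 1 = 1ℚ
PgeomZ-coeff 1 2 = 1ℚ
PgeomZ-coeff 2 2 = + 1 / 4
PgeomZ-coeff 2 3 = + 1 / 4
PgeomZ-coeff (suc (suc (suc _))) 2 = ½
PgeomZ-coeff _ _ = 0ℚ

⊛-geomZ : ∀ A n k → (A ⊛ geomZ) n k ≡ sumTo n (λ i → A i k)
⊛-geomZ A n k = sumTo-cong n column
  where
  column : ∀ i → sumTo k (λ j → A i j * geomZ (n ∸ i) (k ∸ j)) ≡ A i k
  column i = trans (sumTo-single k k _ ℕₚ.≤-refl offDiagonal) onDiagonal
    where
    offDiagonal : ∀ j → j ≤ k → j ≢ k → A i j * geomZ (n ∸ i) (k ∸ j) ≡ 0ℚ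
    offDiagonal j j≤k j≢k =
      trans (cong (λ b → A i j * (if b then 1ℚ else 0ℚ)) (≢⇒≡ᵇ-false (k ∸ j) 0 k∸j≢0)) (*-zeroʳ (A i j))
      where
      k∸j≢0 : k ∸ j ≢ 0
      k∸j≢0 k∸j≡0 = j≢k (ℕₚ.≤-antisym j≤k (ℕₚ.m∸n≡0⇒m≤n k∸j≡0))
    onDiagonal : A i k * geomZ (n ∸ i) (k ∸ k) ≡ A i k
    onDiagonal = trans (cong (λ m → A i k * geomZ (n ∸ i) m) (ℕₚ.n∸n≡0 k)) (*-identityʳ (A i k))

private
  Pexpanded-vanishes : ∀ i k → Pexpanded (4 ℕ.+ i) k ≡ 0ℚ
  Pexpanded-vanishes i 0 = refl
  Pexpanded-vanishes i 1 = refl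
  Pexpanded-vanishes i 2 = refl
  Pexpanded-vanishes i 3 = refl
  Pexpanded-vanishes i (suc (suc (suc (suc k)))) = refl

  partialSum-3 : ∀ k → sumTo 3 (λ i → Pexpanded i k) ≡ PgeomZ-coeff 3 k
  partialSum-3 0 = refl
  partialSum-3 1 = refl
  partialSum-3 2 = refl
  partialSum-3 3 = refl
  partialSum-3 (suc (suc (suc (suc k)))) = refl

  PgeomZ-coeff-stable : ∀ n k → PgeomZ-coeff 3 k ≡ PgeomZ-coeff (3 ℕ.+ n) k
  PgeomZ-coeff-stable n 0 = refl
  PgeomZ-coeff-stable n 1 = refl
  PgeomZ-coeff-stable n 2 = refl
  PgeomZ-coeff-stable n (suc (suc (suc k))) = refl

  partialSums : ∀ n k → sumTo n (λ i → Pexpanded i k) ≡ PgeomZ-coeff n k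
  partialSums 0 0 = refl
  partialSums 0 1 = refl
  partialSums 0 (suc (suc k)) = refl
  partialSums 1 0 = refl
  partialSums 1 1 = refl
  partialSums 1 2 = refl
  partialSums 1 (suc (suc (suc k))) = refl
  partialSums 2 0 = refl
  partialSums 2 1 = refl
  partialSums 2 2 = refl
  partialSums 2 3 = refl
  partialSums 2 (suc (suc (suc (suc k)))) = refl
  partialSums (suc (suc (suc n))) k = begin
    sumTo (3 ℕ.+ n) (λ i → Pexpanded i k) ≡⟨ sumTo-extend (3 ℕ.+ n) 3 _ (ℕₚ.m≤m+n 3 n) beyondDegree ⟩
    sumTo 3 (λ i → Pexpanded i k)         ≡⟨ partialSum-3 k ⟩
    PgeomZ-coeff 3 k                      ≡⟨ PgeomZ-coeff-stable n k ⟩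
    PgeomZ-coeff (3 ℕ.+ n) k              ∎
    where
    open ≡-Reasoning
    beyondDegree : ∀ i → 3 < i → i ≤ 3 ℕ.+ n → Pexpanded i k ≡ 0ℚ
    beyondDegree (suc (suc (suc (suc i)))) _ _ = Pexpanded-vanishes i k
    beyondDegree 1 (s≤s ()) _
    beyondDegree 2 (s≤s (s≤s ())) _
    beyondDegree 3 (s≤s (s≤s (s≤s ()))) _

P⊛geomZ-coeff : ∀ n k → (P ⊛ geomZ) n k ≡ PgeomZ-coeff n k
P⊛geomZ-coeff n k = trans (⊛-geomZ P n k) (trans (sumTo-cong n (λ i → P≈Pexpanded .coeff i k)) (partialSums n k))

-- Both sides satisfy the same recurrence

-- The value of (n + 1) F_{n+1,k} forced by the coefficient of z^n u^k in
-- (1 − uz) ∂F = (uz/2) F + P/(1 − z); it only involves F_n and F_{n−1}.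
recurrenceStep : Series → ℕ → ℕ → ℚ
recurrenceStep F zero k = PgeomZ-coeff 0 k
recurrenceStep F (suc n) zero = PgeomZ-coeff (suc n) 0
recurrenceStep F (suc n) (suc k) = fromℕ (suc n) * F (suc n) k + ½ * F n k + PgeomZ-coeff (suc n) (suc k)

SatisfiesRecurrence : Series → Set
SatisfiesRecurrence F = NoZ⁰Terms F × (∀ n k → fromℕ (suc n) * F (suc n) k ≡ recurrenceStep F n k)

recurrenceStep-cong : ∀ {F F′} n → (∀ k → F n k ≡ F′ n k) → (∀ k → F (suc n) k ≡ F′ (suc n) k) →
                      ∀ k → recurrenceStep F (suc n) k ≡ recurrenceStep F′ (suc n) k
recurrenceStep-cong n Fₙ≡F′ₙ Fₙ₊₁≡F′ₙ₊₁ zero = refl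
recurrenceStep-cong n Fₙ≡F′ₙ Fₙ₊₁≡F′ₙ₊₁ (suc k) =
  cong₂ (λ a b → fromℕ (suc n) * a + ½ * b + PgeomZ-coeff (suc n) (suc k)) (Fₙ₊₁≡F′ₙ₊₁ k) (Fₙ≡F′ₙ k)

recurrence-unique : ∀ {F F′} → SatisfiesRecurrence F → SatisfiesRecurrence F′ → F ≈ F′
recurrence-unique {F} {F′} (F₀≡0 , stepF) (F′₀≡0 , stepF′) .coeff n = proj₁ (agree n)
  where
  agree : ∀ n → (∀ k → F n k ≡ F′ n k) × (∀ k → F (suc n) k ≡ F′ (suc n) k)
  agree zero = (λ k → trans (F₀≡0 k) (sym (F′₀≡0 k))) ,
               (λ k → fromℕ-suc-*-cancelˡ 0 (trans (stepF 0 k) (sym (stepF′ 0 k))))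
  agree (suc n) = proj₂ (agree n) , λ k → fromℕ-suc-*-cancelˡ (suc n) (begin
    fromℕ (suc (suc n)) * F (suc (suc n)) k   ≡⟨ stepF (suc n) k ⟩
    recurrenceStep F (suc n) k                ≡⟨ recurrenceStep-cong n (proj₁ (agree n)) (proj₂ (agree n)) k ⟩
    recurrenceStep F′ (suc n) k               ≡⟨ sym (stepF′ (suc n) k) ⟩
    fromℕ (suc (suc n)) * F′ (suc (suc n)) k  ∎)
    where open ≡-Reasoning

RHS-satisfiesRecurrence : SatisfiesRecurrence RHS
RHS-satisfiesRecurrence = noConstantTerm , step
  where
  noConstantTerm : NoZ⁰Terms RHS
  noConstantTerm k = sumTo-zero k (λ j _ → *-zeroʳ (E 0 j))
  coefficientOfOde : ∀ n k → ∂ RHS n k - shift 1ℚ 1 1 (∂ RHS) n k ≡ shift ½ 1 1 RHS n k + PgeomZ-coeff n k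
  coefficientOfOde n k = trans (sym (oneMinusUZ-⊛ (∂ RHS) .coeff n k))
    (trans (RHS-ode .coeff n k) (cong₂ _+_ (mono-⊛ ½ 1 1 RHS .coeff n k) (P⊛geomZ-coeff n k)))
  unshifted : ∀ x q → x - 0ℚ ≡ 0ℚ + q → x ≡ q
  unshifted x q eq = trans (solve 1 (λ x → x := x :- con 0ℚ) refl x) (trans eq (+-identityˡ q))
  shifted : ∀ x y r q → x - 1ℚ * y ≡ ½ * r + q → x ≡ y + ½ * r + q
  shifted x y r q eq = begin
    x                  ≡⟨ solve 2 (λ x y → x := (x :- con 1ℚ :* y) :+ y) refl x y ⟩
    (x - 1ℚ * y) + y   ≡⟨ cong (_+ y) eq ⟩
    (½ * r + q) + y    ≡⟨ solve 4 (λ y h r q → (h :* r :+ q) :+ y := y :+ h :* r :+ q) refl y ½ r q ⟩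
    y + ½ * r + q      ∎
    where open ≡-Reasoning
  step : ∀ n k → fromℕ (suc n) * RHS (suc n) k ≡ recurrenceStep RHS n k
  step zero k = unshifted _ _ (coefficientOfOde 0 k)
  step (suc n) zero = unshifted _ _ (coefficientOfOde (suc n) 0)
  step (suc n) (suc k) =
    shifted (fromℕ (suc (suc n)) * RHS (suc (suc n)) (suc k)) (fromℕ (suc n) * RHS (suc n) k) (RHS n k) _
            (coefficientOfOde (suc n) (suc k))

private
  g-at-k0 : ∀ n → g n 0 ≡ 0ℚ
  g-at-k0 0 = refl
  g-at-k0 1 = refl
  g-at-k0 2 = refl
  g-at-k0 3 = refl
  g-at-k0 (suc (suc (suc (suc n)))) = refl

  g-at-k1 : ∀ n → g (2 ℕ.+ n) 1 ≡ 0ℚ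
  g-at-k1 0 = refl
  g-at-k1 1 = refl
  g-at-k1 (suc (suc n)) = refl

  fromℕ-suc-*-half-inverse : ∀ n → fromℕ (suc n) * (+ 1 / (2 ℕ.* suc n)) ≡ ½
  fromℕ-suc-*-half-inverse n = begin
    a * w
      ≡⟨ solve 2 (λ a w → a :* w := con ½ :* ((a :+ (a :+ con 0ℚ)) :* w)) refl a w ⟩
    ½ * ((a + (a + 0ℚ)) * w)        ≡⟨ cong (λ t → ½ * (t * w)) (sym twice) ⟩
    ½ * (fromℕ (2 ℕ.* suc n) * w)   ≡⟨ cong (½ *_) (fromℕ-suc-*-inverse (n ℕ.+ suc (n ℕ.+ 0))) ⟩
    ½ * 1ℚ                          ≡⟨ *-identityʳ ½ ⟩
    ½                               ∎
    where
    open ≡-Reasoning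
    a w : ℚ
    a = fromℕ (suc n)
    w = + 1 / (2 ℕ.* suc n)
    twice : fromℕ (2 ℕ.* suc n) ≡ a + (a + 0ℚ)
    twice = trans (fromℕ-+ (suc n) (suc n ℕ.+ 0)) (cong (λ t → a + t) (fromℕ-+ (suc n) 0))

G-satisfiesRecurrence : SatisfiesRecurrence G
G-satisfiesRecurrence = (λ _ → refl) , step
  where
  step : ∀ n k → fromℕ (suc n) * G (suc n) k ≡ recurrenceStep G n k
  -- For n ≤ 3 the g_{n,k} are probabilities over enumerated diagrams: these cases hold by evaluation.
  step 0 0 = refl
  step 0 1 = refl
  step 0 (suc (suc k)) = refl
  step 1 0 = refl
  step 1 1 = refl
  step 1 2 = refl
  step 1 (suc (suc (suc k))) = refl
  step 2 0 = refl
  step 2 1 = refl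
  step 2 2 = refl
  step 2 3 = refl
  step 2 (suc (suc (suc (suc k)))) = refl
  step (suc (suc (suc n))) 0 = *-zeroʳ (fromℕ (4 ℕ.+ n))
  step (suc (suc (suc n))) 1 = begin
    fromℕ (4 ℕ.+ n) * 0ℚ
      ≡⟨ solve 2 (λ a b → a :* con 0ℚ := b :* con 0ℚ :+ con ½ :* con 0ℚ :+ con 0ℚ) refl (fromℕ (4 ℕ.+ n)) b ⟩
    b * 0ℚ + ½ * 0ℚ + 0ℚ
      ≡⟨ cong₂ (λ x y → b * x + ½ * y + 0ℚ) (sym (g-at-k0 (3 ℕ.+ n))) (sym (g-at-k0 (2 ℕ.+ n))) ⟩
    recurrenceStep G (3 ℕ.+ n) 1           ∎
    where
    open ≡-Reasoning
    b : ℚ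
    b = fromℕ (3 ℕ.+ n)
  step (suc (suc (suc n))) 2 = begin
    fromℕ (4 ℕ.+ n) * (+ 1 / (2 ℕ.* (4 ℕ.+ n)))  ≡⟨ fromℕ-suc-*-half-inverse (3 ℕ.+ n) ⟩
    ½
      ≡⟨ solve 1 (λ b → con ½ := b :* con 0ℚ :+ con ½ :* con 0ℚ :+ con ½) refl b ⟩
    b * 0ℚ + ½ * 0ℚ + ½
      ≡⟨ cong₂ (λ x y → b * x + ½ * y + ½) (sym (g-at-k1 (1 ℕ.+ n))) (sym (g-at-k1 n)) ⟩
    recurrenceStep G (3 ℕ.+ n) 2                 ∎
    where
    open ≡-Reasoning
    b : ℚ
    b = fromℕ (3 ℕ.+ n)
  step (suc (suc (suc n))) (suc (suc (suc k))) = begin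
    a * ((1ℚ - w) * x + v * y)
      ≡⟨ solve 5 (λ a w x v y → a :* ((con 1ℚ :- w) :* x :+ v :* y) := a :* x :- (a :* w) :* x :+ (a :* v) :* y) refl a w x v y ⟩
    a * x - (a * w) * x + (a * v) * y
      ≡⟨ cong₂ (λ s t → a * x - s * x + t * y) (fromℕ-suc-*-inverse (3 ℕ.+ n)) (fromℕ-suc-*-half-inverse (3 ℕ.+ n)) ⟩
    a * x - 1ℚ * x + ½ * y
      ≡⟨ solve 3 (λ b x y → (con 1ℚ :+ b) :* x :- con 1ℚ :* x :+ con ½ :* y := b :* x :+ con ½ :* y :+ con 0ℚ) refl b x y ⟩
    b * x + ½ * y + 0ℚ ∎
    where
    open ≡-Reasoning
    a b w v x y : ℚ
    a = fromℕ (4 ℕ.+ n)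
    b = fromℕ (3 ℕ.+ n)
    w = + 1 / (4 ℕ.+ n)
    v = + 1 / (2 ℕ.* (4 ℕ.+ n))
    x = g (3 ℕ.+ n) (suc (suc k))
    y = g (2 ℕ.+ n) (suc (suc k))

lemma4p10 : (n k : ℕ) → G n k ≡ RHS n k
lemma4p10 = recurrence-unique G-satisfiesRecurrence RHS-satisfiesRecurrence .coeff
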